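{- Let $G$ be a graph, $X\subseteq V(G)$, and $(X_1,X_2,\ldots,X_k)$ a simplicial decomposition of $G[X]$. Then $G[X]$ is perfect if and only if $G[X_1]$ is perfect.
   Context: For $S,Y\subseteq V(G)$, $S$ is a simplicial set of $Y$ if for every $s\in S$ the set of neighbors of $s$ in $G[S\cup Y]$ is a clique. A partition $(X_1,\ldots,X_k)$ of $X$ is a simplicial decomposition of $G[X]$ if $X_{i+1}$ is a simplicial set of $X_1\cup\cdots\cup X_i$ for each $i\in\{1,\ldots,k-1\}$. -}

module Defs where

open import Data.Nat using (ℕ; zero; suc; _≤_)
open import Data.Bool using (Bool; true; false)
open import Data.Fin using (Fin; zero; suc; inject₁)
open import Data.Fin.Subset using (Subset; _∈_; _⊆_; _∪_; ∣_∣; Nonempty)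
open import Data.Product using (Σ; ∃; _×_)
open import Relation.Binary.PropositionalEquality using (_≡_; _≢_)

record Graph (n : ℕ) : Set where
  field
    E     : Fin n → Fin n → Bool
    sym   : ∀ u v → E u v ≡ E v u
    irrfl : ∀ v → E v v ≡ false

Adj : ∀ {n} → Graph n → Fin n → Fin n → Set
Adj G u v = Graph.E G u v ≡ true

SimplicialSet : ∀ {n} → Graph n → Subset n → Subset n → Set
SimplicialSet G S Y =
  ∀ s u v → s ∈ S → u ∈ (S ∪ Y) → v ∈ (S ∪ Y) →
  Adj G s u → Adj G s v → u ≢ v → Adj G u v

prefixUnion : ∀ {n k} → (Fin k → Subset n) → Fin k → Subset n
prefixUnion parts zero    = parts zero
prefixUnion parts (suc i) = parts zero ∪ prefixUnion (λ j → parts (suc j)) i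

IsPartition : ∀ {n m} → Subset n → (Fin m → Subset n) → Set
IsPartition X parts =
  (∀ i → Nonempty (parts i)) ×
  (∀ v → v ∈ X → ∃ λ i → v ∈ parts i) ×
  (∀ i v → v ∈ parts i → v ∈ X) ×
  (∀ i j v → v ∈ parts i → v ∈ parts j → i ≡ j)

-- Simplicial decomposition (X_1,...,X_{k+1}) of G[X], indexed from 0:
-- X_{i+1} is a simplicial set of X_1 ∪ ... ∪ X_i.
SimplicialDecomposition : ∀ {n k} → Graph n → Subset n → (Fin (suc k) → Subset n) → Set
SimplicialDecomposition {k = k} G X parts =
  IsPartition X parts ×
  ((i : Fin k) → SimplicialSet G (parts (suc i)) (prefixUnion parts (inject₁ i)))

Colorable : ∀ {n} → Graph n → Subset n → ℕ → Set
Colorable {n} G Y m =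
  Σ ((v : Fin n) → v ∈ Y → Fin m) λ f →
    ∀ u v (u∈ : u ∈ Y) (v∈ : v ∈ Y) → Adj G u v → f u u∈ ≢ f v v∈

IsClique : ∀ {n} → Graph n → Subset n → Set
IsClique G C = ∀ u v → u ∈ C → v ∈ C → u ≢ v → Adj G u v

ChromaticNumber : ∀ {n} → Graph n → Subset n → ℕ → Set
ChromaticNumber G Y m = Colorable G Y m × (∀ j → Colorable G Y j → m ≤ j)

CliqueNumber : ∀ {n} → Graph n → Subset n → ℕ → Set
CliqueNumber G Y m =
  (∃ λ C → C ⊆ Y × IsClique G C × ∣ C ∣ ≡ m) ×
  (∀ C → C ⊆ Y → IsClique G C → ∣ C ∣ ≤ m)

Perfect : ∀ {n} → Graph n → Subset n → Set
Perfect G X = ∀ Y → Y ⊆ X → ∃ λ m → ChromaticNumber G Y m × CliqueNumber G Y m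

{-# OPTIONS --safe #-}
-- If v is simplicial in G[Y], colour G[Y - v] with as many colours as it has clique vertices.
-- Either some colour is missing from the neighbours of v and v takes it, or the neighbours use
-- every colour; then they form, together with v, a clique larger than the palette, and v gets a
-- new colour.  Either way χ ≤ ω passes from G[Y - v] to G[Y].  Every vertex of X_{i+1} is
-- simplicial in any induced subgraph of G[X_1 ∪ ... ∪ X_{i+1}], so deleting those vertices one
-- at a time and inducting on i reduces every induced subgraph of G[X] to one of G[X_1].
module Submission where

open import Defs
open import Algebra.Bundles using (CommutativeMonoid)
open import Data.Bool using (Bool; true)
import Data.Bool.Properties as Bool
open import Data.Empty using (⊥-elim)
open import Data.Fin using (Fin; zero; suc; inject₁; fromℕ; _≟_)
open import Data.Fin.Induction using (<-weakInduction)
open import Data.Fin.Properties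
  using (any?; all?; ¬∀⟶∃¬; suc-injective; 0≢1+n; fromℕ≢inject₁; inject₁-injective)
open import Data.Fin.Subset
  using (Subset; _∈_; _∉_; _⊆_; _∪_; _∩_; _-_; ⁅_⁆; ∣_∣; ⊤; Nonempty; inside; outside)
open import Data.Fin.Subset.Properties
  using ( _∈?_; nonempty?; ∈⊤; ∣⊤∣≡n; ⊆-trans; p⊆p∪q; x∈p∪q⁺; x∈p∪q⁻; x∈p∩q⁺; x∈p∩q⁻
        ; p─q⊆p; x∈p∧x≢y⇒x∈p-y; x∈p⇒∣p-x∣<∣p∣; p⊂q⇒∣p∣<∣q∣; x∈⁅x⁆; x∈⁅y⁆⇒x≡y; ∪-comm
        ; ∪-commutativeMonoid)
open import Data.Nat using (ℕ; suc; _≤_; _<_; z≤n; s≤s)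
open import Data.Nat.Properties using (≤-trans; <-≤-trans; ≤-antisym; ≤-reflexive; ≤-pred; n<1+n)
open import Data.Product using (∃; Σ; _×_; _,_; proj₁; proj₂)
open import Data.Sum using (inj₁; inj₂)
open import Data.Vec using (_∷_; []; tabulate; here; there)
open import Data.Vec.Properties using ([]=⇒lookup; lookup⇒[]=; lookup∘tabulate)
open import Data.Vec.Properties.WithK using ([]=-irrelevant)
open import Function using (_∘_)
open import Function.Bundles using (_⇔_; mk⇔)
open import Relation.Binary.PropositionalEquality
  using (_≡_; _≢_; refl; sym; trans; cong; subst; module ≡-Reasoning)
open import Relation.Nullary using (¬_; Dec; yes; no)
open import Relation.Nullary.Decidable using (_×-dec_; map′)
open import Relation.Unary using (Decidable)

∈-tabulate⁺ : ∀ {n} (h : Fin n → Bool) {x} → h x ≡ true → x ∈ tabulate h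
∈-tabulate⁺ h {x} hx = lookup⇒[]= x (tabulate h) (trans (lookup∘tabulate h x) hx)

∈-tabulate⁻ : ∀ {n} (h : Fin n → Bool) {x} → x ∈ tabulate h → h x ≡ true
∈-tabulate⁻ h {x} x∈ = trans (sym (lookup∘tabulate h x)) ([]=⇒lookup x∈)

⊆-∪-disjoint : ∀ {n} {Y S Z : Subset n} → Y ⊆ S ∪ Z → ¬ Nonempty (Y ∩ S) → Y ⊆ Z
⊆-∪-disjoint {S = S} {Z} Y⊆S∪Z Y∩S-empty {x} x∈Y with x∈p∪q⁻ S Z (Y⊆S∪Z x∈Y)
... | inj₁ x∈S = ⊥-elim (Y∩S-empty (x , x∈p∩q⁺ (x∈Y , x∈S)))
... | inj₂ x∈Z = x∈Z

∣p∣<∣p∪⁅x⁆∣ : ∀ {n} {p : Subset n} {x} → x ∉ p → ∣ p ∣ < ∣ p ∪ ⁅ x ⁆ ∣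
∣p∣<∣p∪⁅x⁆∣ {p = p} {x} x∉p = p⊂q⇒∣p∣<∣q∣ (p⊆p∪q ⁅ x ⁆ , x , x∈p∪q⁺ (inj₂ (x∈⁅x⁆ x)) , x∉p)

injection⇒∣p∣≤∣q∣ : ∀ {m n} {p : Subset m} {q : Subset n} (f : ∀ x → x ∈ p → Fin n) →
  (∀ x x∈p → f x x∈p ∈ q) → (∀ x y x∈p y∈p → f x x∈p ≡ f y y∈p → x ≡ y) → ∣ p ∣ ≤ ∣ q ∣
injection⇒∣p∣≤∣q∣ {p = []} f f∈q f-inj = z≤n
injection⇒∣p∣≤∣q∣ {p = outside ∷ p} f f∈q f-inj =
  injection⇒∣p∣≤∣q∣ (λ x x∈p → f (suc x) (there x∈p)) (λ x x∈p → f∈q (suc x) (there x∈p))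
    (λ x y x∈p y∈p → suc-injective ∘ f-inj (suc x) (suc y) (there x∈p) (there y∈p))
injection⇒∣p∣≤∣q∣ {p = inside ∷ p} {q} f f∈q f-inj =
  <-≤-trans (s≤s (injection⇒∣p∣≤∣q∣ f′ f′∈q-f₀ f′-inj)) (x∈p⇒∣p-x∣<∣p∣ (f∈q zero here))
  where
  f′ : ∀ x → x ∈ p → Fin _
  f′ x x∈p = f (suc x) (there x∈p)
  f′∈q-f₀ : ∀ x x∈p → f′ x x∈p ∈ q - f zero here
  f′∈q-f₀ x x∈p = x∈p∧x≢y⇒x∈p-y (f∈q (suc x) (there x∈p)) (λ e → 0≢1+n (sym (f-inj _ _ _ _ e)))
  f′-inj : ∀ x y x∈p y∈p → f′ x x∈p ≡ f′ y y∈p → x ≡ y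
  f′-inj x y x∈p y∈p = suc-injective ∘ f-inj (suc x) (suc y) (there x∈p) (there y∈p)

Hereditarily : ∀ {n} → (Subset n → Set) → Subset n → Set
Hereditarily P X = ∀ Y → Y ⊆ X → P Y

Hereditarily-anti : ∀ {n} {P : Subset n → Set} {X Y} → Y ⊆ X → Hereditarily P X → Hereditarily P Y
Hereditarily-anti Y⊆X hX Z Z⊆Y = hX Z (⊆-trans Z⊆Y Y⊆X)

Hereditarily-map : ∀ {n} {P Q : Subset n → Set} {X} →
  (∀ {Y} → P Y → Q Y) → Hereditarily P X → Hereditarily Q X
Hereditarily-map P⇒Q hX Y Y⊆X = P⇒Q (hX Y Y⊆X)

prefixUnion-suc : ∀ {n k} (parts : Fin (suc k) → Subset n) (i : Fin k) →
  prefixUnion parts (suc i) ≡ parts (suc i) ∪ prefixUnion parts (inject₁ i)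
prefixUnion-suc parts zero = ∪-comm (parts zero) (parts (suc zero))
prefixUnion-suc {n} parts (suc i) = begin
  parts zero ∪ prefixUnion (parts ∘ suc) (suc i)
    ≡⟨ cong (parts zero ∪_) (prefixUnion-suc (parts ∘ suc) i) ⟩
  parts zero ∪ (parts (suc (suc i)) ∪ prefixUnion (parts ∘ suc) (inject₁ i))
    ≡⟨ x∙yz≈y∙xz (parts zero) (parts (suc (suc i))) _ ⟩
  parts (suc (suc i)) ∪ (parts zero ∪ prefixUnion (parts ∘ suc) (inject₁ i)) ∎
  where
  open ≡-Reasoning
  open import Algebra.Properties.CommutativeSemigroup
    (CommutativeMonoid.commutativeSemigroup (∪-commutativeMonoid n)) using (x∙yz≈y∙xz)

parts⊆prefixUnion-fromℕ : ∀ {n k} (parts : Fin (suc k) → Subset n) (j : Fin (suc k)) →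
  parts j ⊆ prefixUnion parts (fromℕ k)
parts⊆prefixUnion-fromℕ {k = 0} parts zero = λ x∈ → x∈
parts⊆prefixUnion-fromℕ {k = suc k} parts zero = x∈p∪q⁺ ∘ inj₁
parts⊆prefixUnion-fromℕ {k = suc k} parts (suc j) = x∈p∪q⁺ ∘ inj₂ ∘ parts⊆prefixUnion-fromℕ (parts ∘ suc) j

module _ {n : ℕ} (G : Graph n) where

  Adj-sym : ∀ {u v} → Adj G u v → Adj G v u
  Adj-sym {u} {v} uv = trans (Graph.sym G v u) uv

  Adj⇒≢ : ∀ {u v} → Adj G u v → u ≢ v
  Adj⇒≢ {u} uu refl with () ← trans (sym uu) (Graph.irrfl G u)

  neighbours : Fin n → Subset n
  neighbours v = tabulate (Graph.E G v)

  ∈-neighbours⁺ : ∀ {u v} → Adj G v u → u ∈ neighbours v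
  ∈-neighbours⁺ {v = v} = ∈-tabulate⁺ (Graph.E G v)

  ∈-neighbours⁻ : ∀ {u v} → u ∈ neighbours v → Adj G v u
  ∈-neighbours⁻ {v = v} = ∈-tabulate⁻ (Graph.E G v)

  clique≤colors : ∀ {C Y m} → C ⊆ Y → IsClique G C → Colorable G Y m → ∣ C ∣ ≤ m
  clique≤colors {C} {m = m} C⊆Y clique (f , proper) =
    subst (∣ C ∣ ≤_) (∣⊤∣≡n m) (injection⇒∣p∣≤∣q∣ (λ u u∈C → f u (C⊆Y u∈C)) (λ _ _ → ∈⊤) injective)
    where
    injective : ∀ u w u∈C w∈C → f u (C⊆Y u∈C) ≡ f w (C⊆Y w∈C) → u ≡ w
    injective u w u∈C w∈C same with u ≟ w
    ... | yes u≡w = u≡w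
    ... | no u≢w = ⊥-elim (proper u w _ _ (clique u w u∈C w∈C u≢w) same)

  χ≤ω : Subset n → Set
  χ≤ω Y = ∃ λ m → Colorable G Y m × ∃ λ C → C ⊆ Y × IsClique G C × m ≤ ∣ C ∣

  -- Perfect G X unfolds to Hereditarily χ≡ω X.
  χ≡ω : Subset n → Set
  χ≡ω Y = ∃ λ m → ChromaticNumber G Y m × CliqueNumber G Y m

  χ≡ω⇒χ≤ω : ∀ {Y} → χ≡ω Y → χ≤ω Y
  χ≡ω⇒χ≤ω (m , (coloring , _) , ((C , C⊆Y , clique , ∣C∣≡m) , _)) =
    m , coloring , C , C⊆Y , clique , ≤-reflexive (sym ∣C∣≡m)

  χ≤ω⇒χ≡ω : ∀ {Y} → χ≤ω Y → χ≡ω Y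
  χ≤ω⇒χ≡ω (m , coloring , C , C⊆Y , clique , m≤∣C∣) =
    m , (coloring , λ _ → ≤-trans m≤∣C∣ ∘ clique≤colors C⊆Y clique) ,
        ((C , C⊆Y , clique , ∣C∣≡m) , λ D D⊆Y cliqueD → clique≤colors D⊆Y cliqueD coloring)
    where
    ∣C∣≡m : ∣ C ∣ ≡ m
    ∣C∣≡m = ≤-antisym (clique≤colors C⊆Y clique coloring) m≤∣C∣

  ColorUsedAt : ∀ {Y m} → Colorable G Y m → Fin n → Fin m → Set
  ColorUsedAt {Y} (f , _) v k = ∃ λ u → Σ (u ∈ Y) λ u∈Y → Adj G v u × f u u∈Y ≡ k

  colorUsedAt? : ∀ {Y m} (c : Colorable G Y m) v → Decidable (ColorUsedAt c v)
  colorUsedAt? {Y} (f , _) v k = any? usedBy?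
    where
    usedBy? : ∀ u → Dec (Σ (u ∈ Y) λ u∈Y → Adj G v u × f u u∈Y ≡ k)
    usedBy? u with u ∈? Y
    ... | no u∉Y = no (u∉Y ∘ proj₁)
    ... | yes u∈Y = map′ (u∈Y ,_)
      (λ { (u∈Y′ , vu , fu≡k) → vu , subst (λ u∈ → f u u∈ ≡ k) ([]=-irrelevant u∈Y′ u∈Y) fu≡k })
      ((Graph.E G v u Bool.≟ true) ×-dec (f u u∈Y ≟ k))

  extend-coloring : ∀ {Y v m} (c : Colorable G (Y - v) m) (k : Fin m) →
    ¬ ColorUsedAt c v k → Colorable G Y m
  extend-coloring {Y} {v} {m} (f , proper) k unused = f′ , proper′
    where
    color : ∀ u → u ∈ Y → Dec (u ≡ v) → Fin m
    color u u∈Y (yes _)  = k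
    color u u∈Y (no u≢v) = f u (x∈p∧x≢y⇒x∈p-y u∈Y u≢v)
    f′ : ∀ u → u ∈ Y → Fin m
    f′ u u∈Y = color u u∈Y (u ≟ v)
    proper′ : ∀ u w u∈Y w∈Y → Adj G u w → f′ u u∈Y ≢ f′ w w∈Y
    proper′ u w u∈Y w∈Y uw with u ≟ v | w ≟ v
    ... | yes refl | yes refl = λ _ → Adj⇒≢ uw refl
    ... | yes refl | no _     = λ k≡fw → unused (w , _ , uw , sym k≡fw)
    ... | no _     | yes refl = λ fu≡k → unused (u , _ , Adj-sym uw , fu≡k)
    ... | no _     | no _     = proper u w _ _ uw

  colorable-suc : ∀ {Y m} → Colorable G Y m → Colorable G Y (suc m)
  colorable-suc (f , proper) =
    (λ u u∈Y → inject₁ (f u u∈Y)) , λ u w u∈Y w∈Y uw → proper u w u∈Y w∈Y uw ∘ inject₁-injective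

  fromℕ-unused : ∀ {Y m} (c : Colorable G Y m) v → ¬ ColorUsedAt (colorable-suc c) v (fromℕ m)
  fromℕ-unused c v (_ , _ , _ , fu≡last) = fromℕ≢inject₁ (sym fu≡last)

  allColorsUsed⇒≤∣neighbours∣ : ∀ {Y v m} (c : Colorable G (Y - v) m) →
    (∀ k → ColorUsedAt c v k) → m ≤ ∣ Y ∩ neighbours v ∣
  allColorsUsed⇒≤∣neighbours∣ {Y} {v} {m} (f , _) used =
    subst (_≤ ∣ Y ∩ neighbours v ∣) (∣⊤∣≡n m) (injection⇒∣p∣≤∣q∣ witness witness∈ witness-injective)
    where
    witness : ∀ k → k ∈ ⊤ → Fin n
    witness k _ = proj₁ (used k)
    witness∈ : ∀ k k∈⊤ → witness k k∈⊤ ∈ Y ∩ neighbours v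
    witness∈ k _ = let (_ , u∈Y-v , vu , _) = used k in
      x∈p∩q⁺ (p─q⊆p Y ⁅ v ⁆ u∈Y-v , ∈-neighbours⁺ vu)
    witness-injective : ∀ k l k∈⊤ l∈⊤ → witness k k∈⊤ ≡ witness l l∈⊤ → k ≡ l
    witness-injective k l _ _ same with used k | used l
    ... | u , u∈ , _ , fu≡k | _ , u∈′ , _ , fu≡l with refl ← same =
      trans (sym fu≡k) (subst (λ u∈″ → f u u∈″ ≡ l) ([]=-irrelevant u∈′ u∈) fu≡l)

  IsClique-∪⁅⁆ : ∀ {C v} → IsClique G C → (∀ {u} → u ∈ C → Adj G v u) → IsClique G (C ∪ ⁅ v ⁆)
  IsClique-∪⁅⁆ {C} {v} clique adjacent u w u∈ w∈ u≢w with x∈p∪q⁻ C ⁅ v ⁆ u∈ | x∈p∪q⁻ C ⁅ v ⁆ w∈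
  ... | inj₁ u∈C | inj₁ w∈C = clique u w u∈C w∈C u≢w
  ... | inj₁ u∈C | inj₂ w∈v rewrite x∈⁅y⁆⇒x≡y v w∈v = Adj-sym (adjacent u∈C)
  ... | inj₂ u∈v | inj₁ w∈C rewrite x∈⁅y⁆⇒x≡y v u∈v = adjacent w∈C
  ... | inj₂ u∈v | inj₂ w∈v = ⊥-elim (u≢w (trans (x∈⁅y⁆⇒x≡y v u∈v) (sym (x∈⁅y⁆⇒x≡y v w∈v))))

  SimplicialVertex : Subset n → Fin n → Set
  SimplicialVertex Y v = IsClique G (Y ∩ neighbours v)

  χ≤ω-simplicial : ∀ {Y v} → v ∈ Y → SimplicialVertex Y v → χ≤ω (Y - v) → χ≤ω Y
  χ≤ω-simplicial {Y} {v} v∈Y simplicial (m , c , C , C⊆Y-v , clique , m≤∣C∣) with all? (colorUsedAt? c v)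
  ... | yes allUsed =
    suc m , extend-coloring (colorable-suc c) (fromℕ m) (fromℕ-unused c v) ,
    Y ∩ neighbours v ∪ ⁅ v ⁆ , K⊆Y , IsClique-∪⁅⁆ simplicial (∈-neighbours⁻ ∘ proj₂ ∘ x∈p∩q⁻ Y _) ,
    <-≤-trans (s≤s (allColorsUsed⇒≤∣neighbours∣ c allUsed)) (∣p∣<∣p∪⁅x⁆∣ v∉N)
    where
    K⊆Y : Y ∩ neighbours v ∪ ⁅ v ⁆ ⊆ Y
    K⊆Y u∈K with x∈p∪q⁻ (Y ∩ neighbours v) ⁅ v ⁆ u∈K
    ... | inj₁ u∈N = proj₁ (x∈p∩q⁻ Y _ u∈N)
    ... | inj₂ u∈v rewrite x∈⁅y⁆⇒x≡y v u∈v = v∈Y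
    v∉N : v ∉ Y ∩ neighbours v
    v∉N v∈N = Adj⇒≢ (∈-neighbours⁻ (proj₂ (x∈p∩q⁻ Y _ v∈N))) refl
  ... | no notAllUsed =
    let k , unused = ¬∀⟶∃¬ m _ (colorUsedAt? c v) notAllUsed in
    m , extend-coloring c k unused , C , ⊆-trans C⊆Y-v (p─q⊆p Y ⁅ v ⁆) , clique , m≤∣C∣

  SimplicialSet⇒SimplicialVertex : ∀ {S Z Y v} → SimplicialSet G S Z → v ∈ S → Y ⊆ S ∪ Z →
    SimplicialVertex Y v
  SimplicialSet⇒SimplicialVertex {Y = Y} {v} simplicial v∈S Y⊆S∪Z u w u∈ w∈ =
    let u∈Y , vu = x∈p∩q⁻ Y _ u∈ ; w∈Y , vw = x∈p∩q⁻ Y _ w∈ in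
    simplicial v u w v∈S (Y⊆S∪Z u∈Y) (Y⊆S∪Z w∈Y) (∈-neighbours⁻ vu) (∈-neighbours⁻ vw)

  Hereditarily-χ≤ω-∪ : ∀ {S Z} → SimplicialSet G S Z → Hereditarily χ≤ω Z → Hereditarily χ≤ω (S ∪ Z)
  Hereditarily-χ≤ω-∪ {S} {Z} simplicial χ≤ω-Z Y = bySize (suc ∣ Y ∣) Y (n<1+n ∣ Y ∣)
    where
    bySize : ∀ s Y → ∣ Y ∣ < s → Y ⊆ S ∪ Z → χ≤ω Y
    bySize (suc s) Y ∣Y∣<1+s Y⊆S∪Z with nonempty? (Y ∩ S)
    ... | no Y∩S-empty = χ≤ω-Z Y (⊆-∪-disjoint Y⊆S∪Z Y∩S-empty)
    ... | yes (v , v∈Y∩S) =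
      let v∈Y , v∈S = x∈p∩q⁻ Y S v∈Y∩S in
      χ≤ω-simplicial v∈Y (SimplicialSet⇒SimplicialVertex simplicial v∈S Y⊆S∪Z)
        (bySize s (Y - v) (<-≤-trans (x∈p⇒∣p-x∣<∣p∣ v∈Y) (≤-pred ∣Y∣<1+s))
          (⊆-trans (p─q⊆p Y ⁅ v ⁆) Y⊆S∪Z))

proposition4 : (n : ℕ) (G : Graph n) (X : Subset n) (k : ℕ) (parts : Fin (suc k) → Subset n) →
    SimplicialDecomposition G X parts →
    (Perfect G X ⇔ Perfect G (parts zero))
proposition4 n G X k parts ((_ , covered , parts⊆X , _) , simplicial) =
  mk⇔ (Hereditarily-anti (parts⊆X zero _))
      (Hereditarily-map (χ≤ω⇒χ≡ω G) ∘ Hereditarily-anti X⊆prefixUnion ∘ χ≤ω-prefixUnion (fromℕ k))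
  where
  X⊆prefixUnion : X ⊆ prefixUnion parts (fromℕ k)
  X⊆prefixUnion u∈X = let j , u∈parts-j = covered _ u∈X in parts⊆prefixUnion-fromℕ parts j u∈parts-j
  χ≤ω-prefixUnion : ∀ i → Perfect G (parts zero) → Hereditarily (χ≤ω G) (prefixUnion parts i)
  χ≤ω-prefixUnion i perfect₀ =
    <-weakInduction (Hereditarily (χ≤ω G) ∘ prefixUnion parts) (Hereditarily-map (χ≡ω⇒χ≤ω G) perfect₀)
      (λ j χ≤ω-j → subst (Hereditarily (χ≤ω G)) (sym (prefixUnion-suc parts j))
                          (Hereditarily-χ≤ω-∪ G (simplicial j) χ≤ω-j))
      i
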